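{- Every rooted duplication tree $T$ with $n\ge 1$ leaves admits a unique finite list of duplication events $(B_1,B_2,\dots,B_k)$ (possibly $k=0$) with $B_1\preceq B_2\preceq\cdots\preceq B_k$ (i.e. $B_t\preceq B_{t+1}$ for each $1\le t<k$) such that applying $B_1,\dots,B_k$ in this order, starting from the single ancestral gene, produces $T$.
   Context: Tandem duplication event: given the current ordered sequence of genes $(g_1,\dots,g_m)$, an event is a contiguous block of indices $B=\{i,\dots,i+\ell-1\}$ with $1\le i\le i+\ell-1\le m$; applying it replaces $g_i,\dots,g_{i+\ell-1}$ by $\operatorname{lc}(g_i),\dots,\operatorname{lc}(g_{i+\ell-1}),\operatorname{rc}(g_i),\dots,\operatorname{rc}(g_{i+\ell-1})$, where these are distinct new genes that become the left and right child of $g_j$. A rooted duplication tree is obtained by starting from the single gene sequence $(1)$ (the root) and applying a finite sequence of events; it is the rooted binary tree recording this history (duplicated genes are internal nodes with left child $\operatorname{lc}$ and right child $\operatorname{rc}$; leaves are the final genes, with the left-to-right order of the final sequence). Two event sequences produce the same tree if the resulting trees are isomorphic as rooted binary trees with distinguished left/right children and the same leaf order. Order on events (as index sets): $B\prec B'$ iff $\max B<\min B'$; and $B\preceq B'$ iff it is not the case that $B'\prec B$. -}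

module Defs where

open import Data.Bool using (Bool; true; false)
open import Data.Nat using (ℕ; zero; suc; _+_; _≤_)
open import Data.List using (List; []; _∷_; _++_; take; drop; map; length)
open import Data.Product using (_×_; _,_; ∃)
open import Relation.Nullary using (¬_)

-- A gene is identified by its address in the duplication tree: the path
-- from the root, stored REVERSED (most recent step first);
-- false = left child (lc), true = right child (rc).
Gene : Set
Gene = List Bool

-- The final sequence of
-- addresses determines the rooted binary tree (with distinguished
-- left/right children) together with its leaf order, and conversely.
GeneSeq : Set
GeneSeq = List Gene

root : GeneSeq
root = [] ∷ []

lc rc : Gene → Gene
lc g = false ∷ g
rc g = true ∷ g

-- An event (i , ℓ) denotes the block of (0-based) indices {i,…,i+ℓ-1};
-- i.e. the paper's 1-based block {i+1,…,i+ℓ}.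
Event : Set
Event = ℕ × ℕ

-- B ≺ B'  iff  max B < min B'
_≺_ : Event → Event → Set
(i , ℓ) ≺ (i' , ℓ') = i + ℓ ≤ i'

_⪯_ : Event → Event → Set
B ⪯ B' = ¬ (B' ≺ B)

dup : Event → GeneSeq → GeneSeq
dup (i , ℓ) s =
  take i s ++ map lc blk ++ map rc blk ++ drop (i + ℓ) s
  where blk = take ℓ (drop i s)

data Runs : GeneSeq → List Event → GeneSeq → Set where
  done : ∀ {s} → Runs s [] s
  step : ∀ {s i ℓ es t} → 1 ≤ ℓ → i + ℓ ≤ length s →
         Runs (dup (i , ℓ) s) es t → Runs s ((i , ℓ) ∷ es) t

-- A rooted duplication tree (encoded by its final leaf sequence).
IsDupTree : GeneSeq → Set
IsDupTree t = ∃ λ es → Runs root es t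

-- If C = (c , m) lies entirely to the left of B, applying B and then C
-- has the same effect as applying C and then B shifted right by m.  Inserting each
-- event of a run into the canonical form of the rest of the run, moving it past the
-- events entirely to its left, therefore turns any run into a ⪯-chain with the same
-- result.
--
-- Call a position p of a gene sequence visible when the sequence
-- continues at p as lc g₁ … lc gₖ rc g₁ … rc gₖ with k ≥ 1.  The last event (b , ℓ)
-- of a run leaves b visible.  Along a ⪯-chain no position after b is visible,
-- because the genes of a reachable sequence are pairwise incomparable in the tree,
-- hence distinct.  So b is the last visible position of the final sequence, which
-- determines the last event and the sequence before it, and induction from the end
-- of the list concludes.
module Submission where

open import Defs
open import Data.List using (List)
open import Data.List.Relation.Unary.Linked using (Linked)
open import Data.Product using (_×_; ∃)
open import Relation.Binary.PropositionalEquality using (_≡_)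

open import Data.Empty using (⊥-elim)
open import Data.List using ([]; _∷_; _++_; take; drop; map; length; _∷ʳ_)
open import Data.List.Properties
  using (length-++; length-map; length-take; length-drop; take++drop≡id; drop-drop;
         ++-assoc; ++-cancelˡ; ++-cancelʳ; ∷-injective; ∷-injectiveʳ; ∷ʳ-injective)
open import Data.List.Relation.Unary.All as All using (All; []; _∷_)
import Data.List.Relation.Unary.All.Properties as All
open import Data.List.Relation.Unary.AllPairs as AllPairs using (AllPairs; []; _∷_)
import Data.List.Relation.Unary.AllPairs.Properties as AllPairs
open import Data.List.Relation.Unary.Linked using ([]; [-]; _∷_)
open import Data.List.Reverse using (Reverse; []; _∶_∶ʳ_; reverseView)
open import Data.Nat using (ℕ; zero; suc; _+_; _∸_; _≤_; _<_; s≤s; z≤n; _≤?_; pred)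
open import Data.Nat.Properties
open import Algebra.Properties.CommutativeSemigroup +-commutativeSemigroup using (xy∙z≈xz∙y)
open import Data.Product using (_,_; proj₂; ∃₂; map₁; map₂)
open import Data.Sum using (_⊎_; inj₁; inj₂)
open import Function using (_∘_)
open import Relation.Binary.Definitions using (Decidable; tri<; tri≈; tri>)
open import Relation.Binary.PropositionalEquality
  using (_≢_; refl; sym; trans; cong; cong₂; subst; module ≡-Reasoning)
open import Relation.Nullary using (¬_; yes; no)

private
  variable
    A : Set
    R : A → A → Set

length-take-≤ : ∀ {n} (xs : List A) → n ≤ length xs → length (take n xs) ≡ n
length-take-≤ {n = n} xs n≤ = trans (length-take n xs) (m≤n⇒m⊓n≡m n≤)

take-length-++ : ∀ (xs ys : List A) → take (length xs) (xs ++ ys) ≡ xs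
take-length-++ []       ys = refl
take-length-++ (x ∷ xs) ys = cong (x ∷_) (take-length-++ xs ys)

drop-length-++ : ∀ (xs ys : List A) → drop (length xs) (xs ++ ys) ≡ ys
drop-length-++ []       ys = refl
drop-length-++ (x ∷ xs) ys = drop-length-++ xs ys

++-∷-cancelʳ : ∀ (u v : List A) {a b} z → u ++ a ∷ z ≡ v ++ b ∷ z → a ≡ b
++-∷-cancelʳ u v {a} {b} z eq =
  proj₂ (∷ʳ-injective u v (++-cancelʳ z (u ∷ʳ a) (v ∷ʳ b) eq′))
  where
  eq′ : (u ∷ʳ a) ++ z ≡ (v ∷ʳ b) ++ z
  eq′ = trans (++-assoc u (a ∷ []) z) (trans eq (sym (++-assoc v (b ∷ []) z)))

AllPairs-++⁻ : ∀ (xs : List A) {ys} → AllPairs R (xs ++ ys) →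
  AllPairs R xs × AllPairs R ys × All (λ x → All (R x) ys) xs
AllPairs-++⁻ []       rs         = [] , rs , []
AllPairs-++⁻ (x ∷ xs) (rx ∷ rxs) with pxs , pys , cross ← AllPairs-++⁻ xs rxs
                                 | rx-xs , rx-ys ← All.++⁻ xs rx
  = rx-xs ∷ pxs , pys , rx-ys ∷ cross

Linked-∷ʳ⁻ : ∀ (xs : List A) {x} → Linked R (xs ∷ʳ x) → Linked R xs
Linked-∷ʳ⁻ []           _        = []
Linked-∷ʳ⁻ (y ∷ [])     _        = [-]
Linked-∷ʳ⁻ (y ∷ z ∷ xs) (r ∷ rs) = r ∷ Linked-∷ʳ⁻ (z ∷ xs) rs

Linked-last : ∀ (xs : List A) {x y} → Linked R (xs ∷ʳ x ∷ʳ y) → R x y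
Linked-last []           (r ∷ _)  = r
Linked-last (z ∷ [])     (_ ∷ rs) = Linked-last [] rs
Linked-last (z ∷ w ∷ xs) (_ ∷ rs) = Linked-last (w ∷ xs) rs

Applicable : Event → GeneSeq → Set
Applicable (b , ℓ) s = 1 ≤ ℓ × b + ℓ ≤ length s

_≺?_ : Decidable _≺_
(i , ℓ) ≺? (i′ , _) = i + ℓ ≤? i′

dup-prefix : ∀ T Y → dup (0 , length T) (T ++ Y) ≡ map lc T ++ map rc T ++ Y
dup-prefix T Y rewrite take-length-++ T Y | drop-length-++ T Y = refl

dup-shift : ∀ X {Z} c ℓ → dup (length X + c , ℓ) (X ++ Z) ≡ X ++ dup (c , ℓ) Z
dup-shift []      c ℓ = refl
dup-shift (x ∷ X) c ℓ = cong (x ∷_) (dup-shift X c ℓ)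

length-dup : ∀ b ℓ {s} → b + ℓ ≤ length s → length (dup (b , ℓ) s) ≡ length s + ℓ
length-dup (suc b) ℓ {x ∷ s} (s≤s bound) = cong suc (length-dup b ℓ bound)
length-dup zero    ℓ {s}     bound       = begin
    length (map lc T ++ map rc T ++ drop ℓ s)
  ≡⟨ length-++ (map lc T) ⟩
    length (map lc T) + length (map rc T ++ drop ℓ s)
  ≡⟨ cong (length (map lc T) +_) (length-++ (map rc T)) ⟩
    length (map lc T) + (length (map rc T) + length (drop ℓ s))
  ≡⟨ cong₂ _+_ (length-copy lc) (cong₂ _+_ (length-copy rc) (length-drop ℓ s)) ⟩
    ℓ + (ℓ + (length s ∸ ℓ))
  ≡⟨ cong (ℓ +_) (m+[n∸m]≡n bound) ⟩
    ℓ + length s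
  ≡⟨ +-comm ℓ (length s) ⟩
    length s + ℓ
  ∎
  where
  open ≡-Reasoning
  T = take ℓ s
  length-copy : ∀ f → length (map f T) ≡ ℓ
  length-copy f = trans (length-map f T) (length-take-≤ s bound)

dup-comm-prefix : ∀ T {V} d ℓ →
  dup (0 , length T) (dup (length T + d , ℓ) (T ++ V)) ≡
  dup (length T + d + length T , ℓ) (dup (0 , length T) (T ++ V))
dup-comm-prefix T {V} d ℓ = begin
    dup (0 , length T) (dup (length T + d , ℓ) (T ++ V))
  ≡⟨ cong (dup (0 , length T)) (dup-shift T d ℓ) ⟩
    dup (0 , length T) (T ++ dup (d , ℓ) V)
  ≡⟨ dup-prefix T (dup (d , ℓ) V) ⟩
    map lc T ++ map rc T ++ dup (d , ℓ) V
  ≡⟨ ++-assoc (map lc T) (map rc T) (dup (d , ℓ) V) ⟨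
    (map lc T ++ map rc T) ++ dup (d , ℓ) V
  ≡⟨ dup-shift (map lc T ++ map rc T) d ℓ ⟨
    dup (length (map lc T ++ map rc T) + d , ℓ) ((map lc T ++ map rc T) ++ V)
  ≡⟨ cong₂ (λ i s → dup (i , ℓ) s) shifted-start (++-assoc (map lc T) (map rc T) V) ⟩
    dup (length T + d + length T , ℓ) (map lc T ++ map rc T ++ V)
  ≡⟨ cong (dup (length T + d + length T , ℓ)) (dup-prefix T V) ⟨
    dup (length T + d + length T , ℓ) (dup (0 , length T) (T ++ V))
  ∎
  where
  open ≡-Reasoning
  shifted-start : length (map lc T ++ map rc T) + d ≡ length T + d + length T
  shifted-start = begin
      length (map lc T ++ map rc T) + d
    ≡⟨ cong (_+ d) (trans (length-++ (map lc T)) (cong₂ _+_ (length-map lc T) (length-map rc T))) ⟩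
      length T + length T + d
    ≡⟨ xy∙z≈xz∙y (length T) (length T) d ⟩
      length T + d + length T
    ∎

dup-comm : ∀ c m b ℓ s → c + m ≤ b → b ≤ length s →
  dup (c , m) (dup (b , ℓ) s) ≡ dup (b + m , ℓ) (dup (c , m) s)
dup-comm (suc c) m (suc b) ℓ (x ∷ s) (s≤s c+m≤b) (s≤s b≤s) =
  cong (x ∷_) (dup-comm c m b ℓ s c+m≤b b≤s)
dup-comm zero m b ℓ s m≤b b≤s =
  aligned (take m s) (b ∸ m) (length-take-≤ s (≤-trans m≤b b≤s)) (m+[n∸m]≡n m≤b) (take++drop≡id m s)
  where
  aligned : ∀ {m b s} T {V} d → length T ≡ m → m + d ≡ b → T ++ V ≡ s →
    dup (0 , m) (dup (b , ℓ) s) ≡ dup (b + m , ℓ) (dup (0 , m) s)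
  aligned T d refl refl refl = dup-comm-prefix T d ℓ

insert : Event → List Event → List Event
insert B [] = B ∷ []
insert (b , ℓ) ((c , m) ∷ es) with (c , m) ≺? (b , ℓ)
... | yes _ = (c , m) ∷ insert (b + m , ℓ) es
... | no  _ = (b , ℓ) ∷ (c , m) ∷ es

canonical : List Event → List Event
canonical []       = []
canonical (B ∷ es) = insert B (canonical es)

Runs-insert : ∀ {s t} b ℓ es → Applicable (b , ℓ) s → Runs (dup (b , ℓ) s) es t →
  Runs s (insert (b , ℓ) es) t
Runs-insert b ℓ [] (1≤ℓ , bound) done = step 1≤ℓ bound done
Runs-insert {s} {t} b ℓ ((c , m) ∷ es) (1≤ℓ , bound) r@(step 1≤m _ r′) with (c , m) ≺? (b , ℓ)
... | no  _   = step 1≤ℓ bound r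
... | yes c≺b = step 1≤m C-bound (Runs-insert (b + m) ℓ es (1≤ℓ , shifted-bound) swapped)
  where
  C-bound : c + m ≤ length s
  C-bound = ≤-trans c≺b (≤-trans (m≤m+n b ℓ) bound)
  shifted-bound : b + m + ℓ ≤ length (dup (c , m) s)
  shifted-bound = begin
    b + m + ℓ               ≡⟨ xy∙z≈xz∙y b m ℓ ⟩
    b + ℓ + m               ≤⟨ +-monoˡ-≤ m bound ⟩
    length s + m            ≡⟨ length-dup c m C-bound ⟨
    length (dup (c , m) s)  ∎
    where open ≤-Reasoning
  swapped : Runs (dup (b + m , ℓ) (dup (c , m) s)) es t
  swapped = subst (λ u → Runs u es t) (dup-comm c m b ℓ s c≺b (≤-trans (m≤m+n b ℓ) bound)) r′

≺⇒⪯-shift : ∀ {c m b ℓ} → 1 ≤ ℓ → (c , m) ≺ (b , ℓ) → (c , m) ⪯ (b + m , ℓ)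
≺⇒⪯-shift {c} {m} {b} {ℓ} 1≤ℓ c≺b B≺C = <-irrefl refl (begin-strict
  b          ≤⟨ m≤m+n b m ⟩
  b + m      <⟨ m<m+n (b + m) 1≤ℓ ⟩
  b + m + ℓ  ≤⟨ B≺C ⟩
  c          ≤⟨ m≤m+n c m ⟩
  c + m      ≤⟨ c≺b ⟩
  b          ∎)
  where open ≤-Reasoning

Linked-insert-∷ : ∀ {E} b ℓ es → 1 ≤ ℓ → E ⪯ (b , ℓ) → Linked _⪯_ (E ∷ es) →
  Linked _⪯_ (E ∷ insert (b , ℓ) es)
Linked-insert-∷ b ℓ [] _ E⪯B _ = E⪯B ∷ [-]
Linked-insert-∷ b ℓ ((c , m) ∷ es) 1≤ℓ E⪯B (E⪯C ∷ sorted) with (c , m) ≺? (b , ℓ)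
... | yes c≺b = E⪯C ∷ Linked-insert-∷ (b + m) ℓ es 1≤ℓ (≺⇒⪯-shift 1≤ℓ c≺b) sorted
... | no  c⊀b = E⪯B ∷ c⊀b ∷ sorted

Linked-insert : ∀ b ℓ es → 1 ≤ ℓ → Linked _⪯_ es → Linked _⪯_ (insert (b , ℓ) es)
Linked-insert b ℓ [] _ _ = [-]
Linked-insert b ℓ ((c , m) ∷ es) 1≤ℓ sorted with (c , m) ≺? (b , ℓ)
... | yes c≺b = Linked-insert-∷ (b + m) ℓ es 1≤ℓ (≺⇒⪯-shift 1≤ℓ c≺b) sorted
... | no  c⊀b = c⊀b ∷ sorted

Runs-canonical : ∀ {s es t} → Runs s es t → Runs s (canonical es) t
Runs-canonical done                           = done
Runs-canonical (step {i = b} {ℓ} 1≤ℓ bound r) = Runs-insert b ℓ _ (1≤ℓ , bound) (Runs-canonical r)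

Linked-canonical : ∀ {s es t} → Runs s es t → Linked _⪯_ (canonical es)
Linked-canonical done                       = []
Linked-canonical (step {i = b} {ℓ} 1≤ℓ _ r) = Linked-insert b ℓ _ 1≤ℓ (Linked-canonical r)

-- Genes are reversed paths, so g ⊑ d says that d is a descendant of g.
_⊑_ : Gene → Gene → Set
g ⊑ d = ∃ λ w → d ≡ w ++ g

_⋔_ : Gene → Gene → Set
x ⋔ y = ∃ λ z → (lc z ⊑ x × rc z ⊑ y) ⊎ (rc z ⊑ x × lc z ⊑ y)

Antichain : GeneSeq → Set
Antichain = AllPairs _⋔_

⊑-∷ : ∀ {a g d} → g ⊑ d → g ⊑ (a ∷ d)
⊑-∷ {a} (w , refl) = a ∷ w , refl

⋔-sym : ∀ {x y} → x ⋔ y → y ⋔ x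
⋔-sym (z , inj₁ (l , r)) = z , inj₂ (r , l)
⋔-sym (z , inj₂ (r , l)) = z , inj₁ (l , r)

⋔-∷ˡ : ∀ {a x y} → x ⋔ y → (a ∷ x) ⋔ y
⋔-∷ˡ (z , inj₁ (l , r)) = z , inj₁ (⊑-∷ l , r)
⋔-∷ˡ (z , inj₂ (r , l)) = z , inj₂ (⊑-∷ r , l)

⋔-∷ʳ : ∀ {a x y} → x ⋔ y → x ⋔ (a ∷ y)
⋔-∷ʳ = ⋔-sym ∘ ⋔-∷ˡ ∘ ⋔-sym

⋔-∷∷ : ∀ {a b x y} → x ⋔ y → (a ∷ x) ⋔ (b ∷ y)
⋔-∷∷ = ⋔-∷ˡ ∘ ⋔-∷ʳ

lc⋔rc : ∀ x → lc x ⋔ rc x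
lc⋔rc x = x , inj₁ (([] , refl) , ([] , refl))

⋔⇒≢ : ∀ {x y} → x ⋔ y → x ≢ y
⋔⇒≢ (z , inj₁ ((u , refl) , (v , refl))) eq with () ← ++-∷-cancelʳ u v z eq
⋔⇒≢ (z , inj₂ ((u , refl) , (v , refl))) eq with () ← ++-∷-cancelʳ u v z eq

lc⋔rc-all : ∀ {T} → Antichain T → All (λ x → All (λ y → lc x ⋔ rc y) T) T
lc⋔rc-all []                = []
lc⋔rc-all {x ∷ T} (x⋔T ∷ a) =
  (lc⋔rc x ∷ All.map ⋔-∷∷ x⋔T) ∷
  All.zipWith (λ (x⋔y , row) → ⋔-∷∷ (⋔-sym x⋔y) ∷ row) (x⋔T , lc⋔rc-all a)

duplicate-antichain : ∀ T {Y} → Antichain (T ++ Y) → Antichain (map lc T ++ map rc T ++ Y)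
duplicate-antichain T a with aT , aY , T⋔Y ← AllPairs-++⁻ T a =
  AllPairs.++⁺ (AllPairs.map⁺ (AllPairs.map ⋔-∷∷ aT))
    (AllPairs.++⁺ (AllPairs.map⁺ (AllPairs.map ⋔-∷∷ aT)) aY
      (All.map⁺ (All.map (All.map ⋔-∷ˡ) T⋔Y)))
    (All.map⁺ (All.zipWith (λ (row , x⋔Y) → All.++⁺ (All.map⁺ row) (All.map ⋔-∷ˡ x⋔Y))
                           (lc⋔rc-all aT , T⋔Y)))

All-dup : ∀ {P : Gene → Set} → (∀ {a g} → P g → P (a ∷ g)) →
  ∀ b ℓ {s} → b + ℓ ≤ length s → All P s → All P (dup (b , ℓ) s)
All-dup P-∷ zero    ℓ {s}     _           ps        =
  All.++⁺ (All.map⁺ (All.map P-∷ (All.take⁺ ℓ ps)))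
    (All.++⁺ (All.map⁺ (All.map P-∷ (All.take⁺ ℓ ps))) (All.drop⁺ ℓ ps))
All-dup P-∷ (suc b) ℓ {x ∷ s} (s≤s bound) (px ∷ ps) = px ∷ All-dup P-∷ b ℓ bound ps

dup-antichain : ∀ b ℓ {s} → b + ℓ ≤ length s → Antichain s → Antichain (dup (b , ℓ) s)
dup-antichain zero    ℓ {s}     _           a         =
  duplicate-antichain (take ℓ s) (subst Antichain (sym (take++drop≡id ℓ s)) a)
dup-antichain (suc b) ℓ {x ∷ s} (s≤s bound) (x⋔s ∷ a) =
  All-dup ⋔-∷ʳ b ℓ bound x⋔s ∷ dup-antichain b ℓ bound a

Runs-antichain : ∀ {s es t} → Runs s es t → Antichain s → Antichain t
Runs-antichain done                         a = a
Runs-antichain (step {i = b} {ℓ} _ bound r) a = Runs-antichain r (dup-antichain b ℓ bound a)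

Visible : GeneSeq → Set
Visible s = ∃₂ λ g T → ∃ λ Y → s ≡ map lc (g ∷ T) ++ map rc (g ∷ T) ++ Y

NoVisibleFrom : ℕ → GeneSeq → Set
NoVisibleFrom j t = ∀ {p} → j ≤ p → ¬ Visible (drop p t)

map-lc-++-rc-injective : ∀ gs gs′ {x x′ S S′} →
  map lc gs ++ rc x ∷ S ≡ map lc gs′ ++ rc x′ ∷ S′ → gs ≡ gs′ × x ≡ x′ × S ≡ S′
map-lc-++-rc-injective []       []         eq with refl , refl ← ∷-injective eq = refl , refl , refl
map-lc-++-rc-injective (a ∷ gs) (a′ ∷ gs′) eq with refl , eq′ ← ∷-injective eq
  with refl , refl , refl ← map-lc-++-rc-injective gs gs′ eq′ = refl , refl , refl

¬Visible-rc : ∀ {x Z} → ¬ Visible (rc x ∷ Z)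
¬Visible-rc (_ , _ , _ , ())

Visible-lc-rc : ∀ {a gs x Z} → Visible (map lc (a ∷ gs) ++ rc x ∷ Z) → a ≡ x
Visible-lc-rc {a} {gs} (g , T , Y , eq)
  with refl , refl , _ ← map-lc-++-rc-injective (a ∷ gs) (g ∷ T) eq = refl

Visible-drop-rc : ∀ k gs {Z} → Visible (drop k (map rc gs ++ Z)) → Visible (drop (k ∸ length gs) Z)
Visible-drop-rc k       []       v = v
Visible-drop-rc zero    (a ∷ gs) v = ⊥-elim (¬Visible-rc v)
Visible-drop-rc (suc k) (a ∷ gs) v = Visible-drop-rc k gs v

Visible-drop-lc : ∀ k gs {x Z} → All (x ≢_) gs → Visible (drop k (map lc gs ++ rc x ∷ Z)) →
  Visible (drop (k ∸ length gs) (rc x ∷ Z))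
Visible-drop-lc k       []       _          v = v
Visible-drop-lc zero    (a ∷ gs) (x≢a ∷ _)  v = ⊥-elim (x≢a (sym (Visible-lc-rc v)))
Visible-drop-lc (suc k) (a ∷ gs) (_ ∷ x∉gs) v = Visible-drop-lc k gs x∉gs v

NoVisibleFrom-∷⁻ : ∀ j {x s} → NoVisibleFrom j (x ∷ s) → NoVisibleFrom (pred j) s
NoVisibleFrom-∷⁻ zero    none {p} _   = none {suc p} z≤n
NoVisibleFrom-∷⁻ (suc j) none {p} j≤p = none {suc p} (s≤s j≤p)

-- A visible position strictly inside lc T ++ rc T would need two equal genes of the
-- block T; one beyond it is a visible position of the old suffix.
dup-noVisibleFrom : ∀ b ℓ {j s} → Antichain s → NoVisibleFrom j s → j ≤ b + ℓ →
  Applicable (b , ℓ) s → NoVisibleFrom (suc b) (dup (b , ℓ) s)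
dup-noVisibleFrom zero (suc ℓ) {j} {x ∷ s} (x⋔s ∷ _) none j≤ℓ _ {suc q} _ v =
  none j≤ (subst Visible (drop-drop ℓ k s)
    (Visible-drop-rc (q ∸ length T) (x ∷ T)
      (Visible-drop-lc q T (All.map ⋔⇒≢ (All.take⁺ ℓ x⋔s)) v)))
  where
  T = take ℓ s
  k = q ∸ length T ∸ suc (length T)
  j≤ : j ≤ suc (ℓ + k)
  j≤ = ≤-trans j≤ℓ (s≤s (m≤m+n ℓ k))
dup-noVisibleFrom (suc b) ℓ {j} {x ∷ s} (_ ∷ a) none j≤ (1≤ℓ , s≤s bound) {suc p} (s≤s b<p) =
  dup-noVisibleFrom b ℓ a (NoVisibleFrom-∷⁻ j none) (pred-mono-≤ j≤) (1≤ℓ , bound) b<p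

dup-visible : ∀ b ℓ {u} → Applicable (b , ℓ) u → Visible (drop b (dup (b , ℓ) u))
dup-visible zero    (suc ℓ) {x ∷ u} _                 = x , take ℓ u , drop ℓ u , refl
dup-visible (suc b) ℓ       {x ∷ u} (1≤ℓ , s≤s bound) = dup-visible b ℓ (1≤ℓ , bound)

duplicate-injective : ∀ x gs x′ gs′ {Y Y′} →
  map lc (x ∷ gs) ++ map rc (x ∷ gs) ++ Y ≡ map lc (x′ ∷ gs′) ++ map rc (x′ ∷ gs′) ++ Y′ →
  x ∷ gs ≡ x′ ∷ gs′ × Y ≡ Y′
duplicate-injective x gs x′ gs′ eq
  with refl , _ , rest ← map-lc-++-rc-injective (x ∷ gs) (x′ ∷ gs′) eq =
  refl , ++-cancelˡ (map rc gs) _ _ rest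

dup-injective : ∀ b {ℓ ℓ′ u u′} → Applicable (b , ℓ) u → Applicable (b , ℓ′) u′ →
  dup (b , ℓ) u ≡ dup (b , ℓ′) u′ → ℓ ≡ ℓ′ × u ≡ u′
dup-injective zero {suc ℓ} {suc ℓ′} {x ∷ u} {x′ ∷ u′} (_ , s≤s bound) (_ , s≤s bound′) eq
  with T≡T′ , Y≡Y′ ← duplicate-injective x (take ℓ u) x′ (take ℓ′ u′) eq =
  cong suc (begin
    ℓ                   ≡⟨ length-take-≤ u bound ⟨
    length (take ℓ u)   ≡⟨ cong length (∷-injectiveʳ T≡T′) ⟩
    length (take ℓ′ u′) ≡⟨ length-take-≤ u′ bound′ ⟩
    ℓ′                  ∎) ,
  (begin
    x ∷ u                           ≡⟨ cong (x ∷_) (take++drop≡id ℓ u) ⟨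
    (x ∷ take ℓ u) ++ drop ℓ u      ≡⟨ cong₂ _++_ T≡T′ Y≡Y′ ⟩
    (x′ ∷ take ℓ′ u′) ++ drop ℓ′ u′ ≡⟨ cong (x′ ∷_) (take++drop≡id ℓ′ u′) ⟩
    x′ ∷ u′                         ∎)
  where open ≡-Reasoning
dup-injective (suc b) {u = x ∷ u} {x′ ∷ u′} (1≤ℓ , s≤s bound) (1≤ℓ′ , s≤s bound′) eq
  with refl , eq′ ← ∷-injective eq =
  map₂ (cong (x ∷_)) (dup-injective b (1≤ℓ , bound) (1≤ℓ′ , bound′) eq′)

last-event-unique : ∀ {b ℓ u b′ ℓ′ u′ t} → Applicable (b , ℓ) u → Applicable (b′ , ℓ′) u′ →
  NoVisibleFrom (suc b) t → NoVisibleFrom (suc b′) t → t ≡ dup (b , ℓ) u → t ≡ dup (b′ , ℓ′) u′ →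
  b ≡ b′ × ℓ ≡ ℓ′ × u ≡ u′
last-event-unique {b} {ℓ} {b′ = b′} {ℓ′} B-ok B′-ok none none′ refl eq with <-cmp b b′
... | tri< b<b′ _ _ =
  ⊥-elim (none b<b′ (subst (Visible ∘ drop b′) (sym eq) (dup-visible b′ ℓ′ B′-ok)))
... | tri> _ _ b′<b = ⊥-elim (none′ b′<b (dup-visible b ℓ B-ok))
... | tri≈ _ refl _ = refl , dup-injective b B-ok B′-ok eq

Runs-∷ʳ⁻ : ∀ es {s B t} → Runs s (es ∷ʳ B) t → ∃ λ u → Runs s es u × Applicable B u × t ≡ dup B u
Runs-∷ʳ⁻ []       (step 1≤ℓ bound done) = _ , done , (1≤ℓ , bound) , refl
Runs-∷ʳ⁻ (_ ∷ es) (step 1≤ℓ bound r)    = map₂ (map₁ (step 1≤ℓ bound)) (Runs-∷ʳ⁻ es r)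

length-Runs : ∀ {s es t} → Runs s es t → length s ≤ length t
length-Runs done                             = ≤-refl
length-Runs {s} (step {i = b} {ℓ} _ bound r) = begin
  length s                ≤⟨ m≤m+n (length s) ℓ ⟩
  length s + ℓ            ≡⟨ length-dup b ℓ bound ⟨
  length (dup (b , ℓ) s)  ≤⟨ length-Runs r ⟩
  _                       ∎
  where open ≤-Reasoning

Runs-∷ʳ-length : ∀ es {s b ℓ t} → Runs s (es ∷ʳ (b , ℓ)) t → length s < length t
Runs-∷ʳ-length es {s} {b} {ℓ} r with u , r′ , (1≤ℓ , bound) , refl ← Runs-∷ʳ⁻ es r = begin-strict
  length s                ≤⟨ length-Runs r′ ⟩
  length u                <⟨ m<m+n (length u) 1≤ℓ ⟩
  length u + ℓ            ≡⟨ length-dup b ℓ bound ⟨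
  length (dup (b , ℓ) u)  ∎
  where open ≤-Reasoning

canonical-noVisibleFrom : ∀ {es b ℓ t} → Reverse es → Linked _⪯_ (es ∷ʳ (b , ℓ)) →
  Runs root (es ∷ʳ (b , ℓ)) t → NoVisibleFrom (suc b) t
canonical-noVisibleFrom {b = b} {ℓ} [] _ (step 1≤ℓ bound done) =
  dup-noVisibleFrom b ℓ (All.[] ∷ []) root-none z≤n (1≤ℓ , bound)
  where
  root-none : NoVisibleFrom 0 root
  root-none {zero}        _ (_ , _ , _ , ())
  root-none {suc zero}    _ (_ , _ , _ , ())
  root-none {suc (suc p)} _ (_ , _ , _ , ())
canonical-noVisibleFrom {b = b} {ℓ} (xs ∶ rxs ∶ʳ B′) sorted r
  with u , r′ , B-ok , refl ← Runs-∷ʳ⁻ (xs ∷ʳ B′) r =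
  dup-noVisibleFrom b ℓ (Runs-antichain r′ (All.[] ∷ []))
    (canonical-noVisibleFrom rxs (Linked-∷ʳ⁻ (xs ∷ʳ B′) sorted) r′)
    (≰⇒> (Linked-last xs sorted)) B-ok

canonical-unique : ∀ {es es′ t} → Reverse es → Reverse es′ → Linked _⪯_ es → Linked _⪯_ es′ →
  Runs root es t → Runs root es′ t → es ≡ es′
canonical-unique [] [] _ _ _ _ = refl
canonical-unique [] (ys ∶ _ ∶ʳ _) _ _ done r′ = ⊥-elim (<-irrefl refl (Runs-∷ʳ-length ys r′))
canonical-unique (xs ∶ _ ∶ʳ _) [] _ _ r done = ⊥-elim (<-irrefl refl (Runs-∷ʳ-length xs r))
canonical-unique (xs ∶ rxs ∶ʳ B) (ys ∶ rys ∶ʳ B′) sorted sorted′ r r′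
  with u , ru , B-ok , eq ← Runs-∷ʳ⁻ xs r
     | u′ , ru′ , B′-ok , eq′ ← Runs-∷ʳ⁻ ys r′
  with refl , refl , refl ← last-event-unique B-ok B′-ok
         (canonical-noVisibleFrom rxs sorted r) (canonical-noVisibleFrom rys sorted′ r′) eq eq′ =
  cong (_∷ʳ B) (canonical-unique rxs rys (Linked-∷ʳ⁻ xs sorted) (Linked-∷ʳ⁻ ys sorted′) ru ru′)

lemma5 : (t : GeneSeq) → IsDupTree t →
           ∃ λ (es : List Event) →
             (Linked _⪯_ es × Runs root es t) ×
             (∀ (es' : List Event) → Linked _⪯_ es' → Runs root es' t → es' ≡ es)
lemma5 t (es , r) =
  canonical es , (Linked-canonical r , Runs-canonical r) ,
  λ es′ sorted′ r′ → canonical-unique (reverseView es′) (reverseView (canonical es))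
                       sorted′ (Linked-canonical r) r′ (Runs-canonical r)
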